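{- For any set $S \subseteq V$ and any subset $T \subseteq S$ of conflicting nodes, the inequality $\sum_{a \in \delta^-(S) \cap A^{ - }_{T}} y_a + \sum_{a \in \delta^+(S) \cap A^{+}_{T}} y_a \geq \sum_{i\in T} z_i$ is valid for $\mathcal{P}$.
   Context: Let $G=(V,A)$ be a DAG with $V=\{1,\dots,n\}$ and $\check{A}\subseteq A$. Let $\bar{G}=(\bar V,\bar A)$ with $\bar V=\{0\}\cup V\cup\{\bar n\}$, $\bar n=n+1$, and $\bar A=\{(0,i):i\in V\}\cup A\cup\{(i,\bar n):i\in V\}$. For $S\subseteq\bar V$, $\delta^+(S)$ (resp. $\delta^-(S)$) denotes the arcs of $\bar A$ leaving (resp. entering) $S$. A path in $\bar G$ is feasible if it traverses at least one arc of $\check{A}$, and infeasible otherwise. $\mathcal{P}$ is the convex hull of all binary vectors $y\in\{0,1\}^{|\bar A|}$ satisfying $\sum_{a\in\delta^-(i)}y_a\le 1$ and $\sum_{a\in\delta^-(i)}y_a=\sum_{a\in\delta^+(i)}y_a$ for all $i\in V$, and $\sum_{i=0}^h y_{(v_i,v_{i+1})}\le h$ for every infeasible path $(v_0=0,v_1,\dots,v_h,v_{h+1}=\bar n)$. For $i\in V$, $z_i=\sum_{a\in\delta^-(i)}y_a$. Two nodes are conflicting if no path in $\bar G$ passes through both; a set of conflicting nodes is a set of pairwise conflicting nodes. For each $i\in V$, $A^{ - }_{i}$ (resp. $A^{+}_{i}$) is the set of arcs of all feasible paths of the form $(0,\ldots,i)$ (resp. $(i,\ldots,\bar n)$); $A^{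 - }_{T}=\bigcup_{i\in T}A^{ - }_{i}$ and $A^{+}_{T}=\bigcup_{i\in T}A^{+}_{i}$.
   Formalization: Validity for $\mathcal{P}$ is asserted only at the points that are convex combinations with rational weights of the admissible binary vectors, rather than at all real points of the convex hull. -}

module Defs where

open import Data.Nat as ℕ using (ℕ; zero; suc)
open import Data.Integer using (+_)
open import Data.Rational as ℚ using (ℚ; 0ℚ; 1ℚ)
open import Data.Bool using (Bool; true; false; T; if_then_else_; _∧_; not)
open import Data.Fin using (Fin)
open import Data.List using (List; []; _∷_; _++_; map; foldr; length; concatMap; allFin) public
open import Data.List.Membership.Propositional using (_∈_)
open import Data.List.Relation.Unary.All using (All)
open import Data.Product using (Σ; _×_; proj₁; proj₂)
open import Data.Empty using (⊥)
open import Relation.Nullary using (¬_)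
open import Relation.Binary.PropositionalEquality using (_≡_; _≢_)

data Reach {n : ℕ} (E : Fin n → Fin n → Bool) : Fin n → Fin n → Set where
  one  : ∀ {i j} → T (E i j) → Reach E i j
  more : ∀ {i j k} → T (E i j) → Reach E j k → Reach E i k

record DAG (n : ℕ) : Set where
  field
    A       : Fin n → Fin n → Bool
    Ǎ       : Fin n → Fin n → Bool
    Ǎ⊆A     : ∀ i j → T (Ǎ i j) → T (A i j)
    acyclic : ∀ i → ¬ Reach A i i

-- The extended graph Ḡ = (V̄, Ā), V̄ = {0} ∪ V ∪ {n̄}.

data Node (n : ℕ) : Set where
  src : Node n
  mid : Fin n → Node n
  snk : Node n

allNodes : (n : ℕ) → List (Node n)
allNodes n = src ∷ (map mid (allFin n) ++ (snk ∷ []))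

module _ {n : ℕ} (G : DAG n) where
  open DAG G

  arcBar : Node n → Node n → Bool
  arcBar src     (mid _) = true
  arcBar (mid i) (mid j) = A i j
  arcBar (mid _) snk     = true
  arcBar _       _       = false

  checkArc : Node n → Node n → Bool
  checkArc (mid i) (mid j) = Ǎ i j
  checkArc _       _       = false

  -- walks (node sequences, consecutive nodes joined by arcs of Ā) in Ḡ;
  -- since Ḡ is acyclic every walk is a path.
  data IsPath : List (Node n) → Set where
    single : ∀ u → IsPath (u ∷ [])
    cons   : ∀ {u w ws} → T (arcBar u w) → IsPath (w ∷ ws) → IsPath (u ∷ w ∷ ws)

  data ArcOn (u w : Node n) : List (Node n) → Set where
    here  : ∀ {ws} → ArcOn u w (u ∷ w ∷ ws)
    there : ∀ {x xs} → ArcOn u w xs → ArcOn u w (x ∷ xs)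

  Feasible : List (Node n) → Set
  Feasible ps = Σ (Node n) λ u → Σ (Node n) λ w → ArcOn u w ps × T (checkArc u w)

  Conflicting : Fin n → Fin n → Set
  Conflicting i j =
    ¬ (Σ (List (Node n)) λ ps → IsPath ps × (mid i ∈ ps) × (mid j ∈ ps))

  ConflictingSet : (Fin n → Bool) → Set
  ConflictingSet Tset = ∀ i j → T (Tset i) → T (Tset j) → i ≢ j → Conflicting i j

  InAminus : Fin n → Node n → Node n → Set
  InAminus i u w = Σ (List (Node n)) λ qs →
    let ps = src ∷ (qs ++ (mid i ∷ [])) in IsPath ps × Feasible ps × ArcOn u w ps

  InAplus : Fin n → Node n → Node n → Set
  InAplus i u w = Σ (List (Node n)) λ qs →
    let ps = mid i ∷ (qs ++ (snk ∷ [])) in IsPath ps × Feasible ps × ArcOn u w ps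

  InAminusT InAplusT : (Fin n → Bool) → Node n → Node n → Set
  InAminusT Tset u w = Σ (Fin n) λ i → T (Tset i) × InAminus i u w
  InAplusT  Tset u w = Σ (Fin n) λ i → T (Tset i) × InAplus i u w

  -- Integer points: vectors indexed by pairs of nodes of Ḡ which vanish
  -- outside Ā (i.e. vectors of {0,1}^{Ā}).

  sumℕ : List ℕ → ℕ
  sumℕ = foldr ℕ._+_ 0

  inSumℕ outSumℕ : (Node n → Node n → ℕ) → Node n → ℕ
  inSumℕ  x w = sumℕ (map (λ u → if arcBar u w then x u w else 0) (allNodes n))
  outSumℕ x u = sumℕ (map (λ w → if arcBar u w then x u w else 0) (allNodes n))

  pathSumℕ : (Node n → Node n → ℕ) → List (Node n) → ℕ
  pathSumℕ x (u ∷ w ∷ ws) = x u w ℕ.+ pathSumℕ x (w ∷ ws)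
  pathSumℕ x _            = 0

  record Admissible (x : Node n → Node n → ℕ) : Set where
    field
      binary   : ∀ u w → x u w ℕ.≤ 1
      support  : ∀ u w → arcBar u w ≡ false → x u w ≡ 0
      indeg≤1  : ∀ i → inSumℕ x (mid i) ℕ.≤ 1
      flow     : ∀ i → inSumℕ x (mid i) ≡ outSumℕ x (mid i)
      infeas   : ∀ qs → let ps = src ∷ (qs ++ (snk ∷ [])) in
                 IsPath ps → ¬ Feasible ps → pathSumℕ x ps ℕ.≤ length qs

  -- The polytope 𝒫 = conv(admissible binary vectors), with rational
  -- convex-combination coefficients.

  toℚ : ℕ → ℚ
  toℚ k = (+ k) ℚ./ 1

  sumℚ : List ℚ → ℚ
  sumℚ = foldr ℚ._+_ 0ℚ

  InP : (Node n → Node n → ℚ) → Set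
  InP y = Σ (List (ℚ × (Node n → Node n → ℕ))) λ cs →
            All (λ c → (0ℚ ℚ.≤ proj₁ c) × Admissible (proj₂ c)) cs
          × sumℚ (map proj₁ cs) ≡ 1ℚ
          × (∀ u w → y u w ≡ sumℚ (map (λ c → proj₁ c ℚ.* toℚ (proj₂ c u w)) cs))

  sumPairs : (Node n → Node n → Bool) → (Node n → Node n → ℚ) → ℚ
  sumPairs P y = sumℚ (concatMap (λ u → map (λ w → if P u w then y u w else 0ℚ)
                                            (allNodes n)) (allNodes n))

  z : (Node n → Node n → ℚ) → Fin n → ℚ
  z y i = sumℚ (map (λ u → if arcBar u (mid i) then y u (mid i) else 0ℚ) (allNodes n))

  inS : (Fin n → Bool) → Node n → Bool
  inS S (mid i) = S i
  inS S _       = false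

{-# OPTIONS --safe #-}
-- Both sides are linear in y and the weights of a convex combination are
-- nonnegative, so it suffices to prove the inequality at the integer points x
-- of 𝒫.  Such an x is a family of node-disjoint 0–n̄ paths, and by the
-- infeasible-path inequalities each of them traverses an arc of Ǎ.  For i ∈ T
-- with z_i = 1 that arc lies on the x-path either before i or after i.  In the
-- first case the part (0,…,i) is a feasible path which starts outside S and ends
-- in S, so one of its arcs lies in δ⁻(S) ∩ A⁻_T; in the second case the part
-- (i,…,n̄) leaves S through an arc of δ⁺(S) ∩ A⁺_T.  Distinct nodes of T are
-- charged to distinct arcs: since in- and out-degrees of x are at most one, two
-- nodes charged to the same arc would lie on a common path, which conflicting
-- nodes do not.
module Submission where

open import Defs
open import Data.Nat using (ℕ)
open import Data.Fin using (Fin)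
open import Data.Bool using (Bool; T; _∧_; not; if_then_else_)
open import Data.List using (map; allFin)
open import Data.Product using (_×_)
open import Data.Rational using (ℚ; 0ℚ; _≤_; _+_)

open import Level using (Level; 0ℓ)
open import Algebra.Bundles using (CommutativeMonoid)
open import Data.Bool using (true; false)
open import Data.Empty using (⊥-elim)
open import Data.Fin.Induction using (spo-wellFounded; spo-noetherian)
import Data.Integer as ℤ
import Data.Integer.Properties as ℤ
open import Data.List using (List; []; _∷_; _++_; length; foldr; concatMap; cartesianProduct)
open import Data.List.Membership.Propositional using (_∈_)
open import Data.List.Membership.Propositional.Properties
  using (∈-map⁺; ∈-∃++; ∈-++⁺ˡ; ∈-++⁺ʳ; ∈-allFin; ∈-cartesianProduct⁺)
open import Data.List.Properties using (map-++; map-∘)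
open import Data.List.Relation.Binary.Permutation.Propositional using (↭-sym)
open import Data.List.Relation.Binary.Permutation.Propositional.Properties as ↭ using (∈-resp-↭; shift)
open import Data.List.Relation.Unary.All as All using (All; []; _∷_)
open import Data.List.Relation.Unary.AllPairs using (_∷_)
open import Data.List.Relation.Unary.Any using (Any; here; there)
open import Data.List.Relation.Unary.Any.Properties using (++⁺ʳ)
open import Data.List.Relation.Unary.Linked as Linked using (Linked; [-]; _∷_)
open import Data.List.Relation.Unary.Unique.Propositional using (Unique)
open import Data.List.Relation.Unary.Unique.Propositional.Properties using (allFin⁺)
open import Data.Nat as ℕ using (suc; z≤n; _<_)
open import Data.Nat.Coprimality using (1-coprimeTo) renaming (sym to coprime-sym)
open import Data.Nat.ListAction using (sum)
open import Data.Nat.ListAction.Properties using (sum-↭)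
open import Data.Nat.Properties as ℕ
  using (≤-trans; ≤-reflexive; +-mono-≤; m≤m+n; m≤n+m; n≮n; ≮⇒≥; n≤0⇒n≡0; _<?_)
open import Data.Product using (∃; ∃₂; _,_; proj₁; proj₂)
open import Data.Rational as ℚ using (mkℚ; _/_; _*_)
import Data.Rational.Properties as ℚ
open import Data.Sum as Sum using (_⊎_; inj₁; inj₂)
open import Data.Unit using (tt)
open import Function using (_∘_; flip; id)
open import Induction.WellFounded using (Acc; acc; WellFounded)
open import Relation.Binary using (Rel; IsStrictPartialOrder; Transitive)
open import Relation.Binary.Construct.Closure.ReflexiveTransitive using (Star; ε; _◅_; _◅◅_; reverse)
open import Relation.Binary.PropositionalEquality
open import Relation.Nullary using (¬_; Dec; yes; no; contradiction; T?)
open import Algebra.Properties.CommutativeSemigroup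
  (CommutativeMonoid.commutativeSemigroup ℚ.+-0-commutativeMonoid) using (interchange)

module _ {A : Set} where

  ∈⇒≤sum-map : ∀ (h : A → ℕ) {a xs} → a ∈ xs → h a ℕ.≤ sum (map h xs)
  ∈⇒≤sum-map h {xs = a ∷ xs} (here refl)  = m≤m+n (h a) _
  ∈⇒≤sum-map h {xs = b ∷ xs} (there a∈xs) = ≤-trans (∈⇒≤sum-map h a∈xs) (m≤n+m _ (h b))

  sum-map-pos⇒∃-pos : ∀ (h : A → ℕ) xs → 0 < sum (map h xs) → ∃ λ a → 0 < h a
  sum-map-pos⇒∃-pos h (a ∷ xs) sum>0 with 0 <? h a
  ... | yes ha>0 = a , ha>0
  ... | no  ha≯0 rewrite n≤0⇒n≡0 (≮⇒≥ ha≯0) = sum-map-pos⇒∃-pos h xs sum>0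

  sum-map≤1⇒pos-unique : ∀ (h : A → ℕ) {a b xs} → sum (map h xs) ℕ.≤ 1 →
                         a ∈ xs → b ∈ xs → 0 < h a → 0 < h b → a ≡ b
  sum-map≤1⇒pos-unique h _ (here refl) (here refl) _ _ = refl
  sum-map≤1⇒pos-unique h sum≤1 (here refl) (there b∈xs) ha>0 hb>0 =
    contradiction (≤-trans (+-mono-≤ ha>0 (≤-trans hb>0 (∈⇒≤sum-map h b∈xs))) sum≤1) (n≮n 1)
  sum-map≤1⇒pos-unique h sum≤1 (there a∈xs) (here refl) ha>0 hb>0 =
    contradiction (≤-trans (+-mono-≤ hb>0 (≤-trans ha>0 (∈⇒≤sum-map h a∈xs))) sum≤1) (n≮n 1)
  sum-map≤1⇒pos-unique h {xs = c ∷ xs} sum≤1 (there a∈xs) (there b∈xs) =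
    sum-map≤1⇒pos-unique h (≤-trans (m≤n+m _ (h c)) sum≤1) a∈xs b∈xs

module _ {A B : Set} (f : A → ℕ) (g : B → ℕ) (σ : ∀ a → 0 < f a → B)
         (f≤g∘σ : ∀ a fa>0 → f a ℕ.≤ g (σ a fa>0))
         (σ-injective : ∀ {a a′} fa>0 fa′>0 → a ≢ a′ → σ a fa>0 ≢ σ a′ fa′>0) where

  sum-map-≤-injection : ∀ {as bs} → Unique as → (∀ {a} → a ∈ as → ∀ fa>0 → σ a fa>0 ∈ bs) →
                        sum (map f as) ℕ.≤ sum (map g bs)
  sum-map-≤-injection {[]}     _            _    = z≤n
  sum-map-≤-injection {a ∷ as} (a∉as ∷ uniq) σ∈bs with 0 <? f a
  ... | no fa≯0 rewrite n≤0⇒n≡0 (≮⇒≥ fa≯0) = sum-map-≤-injection uniq (σ∈bs ∘ there)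
  ... | yes fa>0 with bs₁ , bs₂ , refl ← ∈-∃++ (σ∈bs (here refl) fa>0) =
    ≤-trans (+-mono-≤ (f≤g∘σ a fa>0) (sum-map-≤-injection uniq σ∈rest))
            (≤-reflexive (sum-↭ (↭.map⁺ g (↭-sym (shift _ bs₁ bs₂)))))
    where
    σ∈rest : ∀ {a′} → a′ ∈ as → ∀ fa′>0 → σ a′ fa′>0 ∈ bs₁ ++ bs₂
    σ∈rest a′∈as fa′>0 with ∈-resp-↭ (shift _ bs₁ bs₂) (σ∈bs (there a′∈as) fa′>0)
    ... | here σa′≡σa =
      contradiction (sym σa′≡σa) (σ-injective fa>0 fa′>0 (All.lookup a∉as a′∈as))
    ... | there σa′∈  = σa′∈

if-T : ∀ {A : Set} {b} {p q : A} → T b → (if b then p else q) ≡ p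
if-T {b = true} _ = refl

if-pos : ∀ b {m} → 0 < (if b then m else 0) → T b × 0 < m
if-pos true m>0 = tt , m>0

∧-intro : ∀ {a b} → T a → T b → T (a ∧ b)
∧-intro {true} _ tb = tb

T-not⊎T : ∀ b → T (not b) ⊎ T b
T-not⊎T false = inj₁ tt
T-not⊎T true  = inj₂ tt

map-cartesianProduct : ∀ {A B C : Set} (f : A × B → C) xs ys →
                       map f (cartesianProduct xs ys) ≡ concatMap (λ a → map (λ b → f (a , b)) ys) xs
map-cartesianProduct f []       ys = refl
map-cartesianProduct f (a ∷ xs) ys = begin
  map f (map (a ,_) ys ++ cartesianProduct xs ys)          ≡⟨ map-++ f (map (a ,_) ys) _ ⟩
  map f (map (a ,_) ys) ++ map f (cartesianProduct xs ys)  ≡⟨ cong₂ _++_ (sym (map-∘ ys))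
                                                                        (map-cartesianProduct f xs ys) ⟩
  map (λ b → f (a , b)) ys ++ concatMap (λ a → map (λ b → f (a , b)) ys) xs ∎
  where open ≡-Reasoning

module _ {A : Set} {ℓ p : Level} {_⟶_ : Rel A ℓ} {P : A → Set p}
         (deterministic : ∀ {u a b} → P u → u ⟶ a → u ⟶ b → a ≡ b)
         (P-closed : ∀ {u w} → u ⟶ w → P w) where

  Star-comparable : ∀ {v a b} → P v → Star _⟶_ v a → Star _⟶_ v b →
                    Star _⟶_ a b ⊎ Star _⟶_ b a
  Star-comparable _  ε          v↝b        = inj₁ v↝b
  Star-comparable _  v↝a        ε          = inj₂ v↝a
  Star-comparable Pv (r ◅ v↝a) (r′ ◅ v↝b) with refl ← deterministic Pv r r′ =
    Star-comparable (P-closed r) v↝a v↝b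

-- The interior vertices are explicit, as in the paths (0,…,i) and (i,…,n̄) of InAminus and InAplus.
Walk : ∀ {A : Set} {ℓ} → Rel A ℓ → A → List A → A → Set ℓ
Walk R u vs w = Linked R (u ∷ vs ++ w ∷ [])

module _ {A : Set} {ℓ : Level} {R : Rel A ℓ} where

  walk-++ : ∀ {u v w vs ws} → Walk R u vs v → Walk R v ws w → Walk R u (vs ++ v ∷ ws) w
  walk-++ {vs = []}    (r ∷ [-]) W′ = r ∷ W′
  walk-++ {vs = _ ∷ _} (r ∷ W)   W′ = r ∷ walk-++ W W′

  walk⇒Star : ∀ {u vs w} → Walk R u vs w → Star R u w
  walk⇒Star {vs = []}    (r ∷ [-]) = r ◅ ε
  walk⇒Star {vs = _ ∷ _} (r ∷ W)   = r ◅ walk⇒Star W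

-- Linear forms on arc vectors

-- Definitionally equal to sumℚ G and toℚ G of Defs, which do not depend on G.
Σℚ : List ℚ → ℚ
Σℚ = foldr _+_ 0ℚ

fromℕ : ℕ → ℚ
fromℕ k = ℤ.+ k / 1

fromℕ≡mkℚ : ∀ k → fromℕ k ≡ mkℚ (ℤ.+ k) 0 (coprime-sym (1-coprimeTo k))
fromℕ≡mkℚ k = ℚ.normalize-coprime (coprime-sym (1-coprimeTo k))

fromℕ-+ : ∀ a b → fromℕ (a ℕ.+ b) ≡ fromℕ a + fromℕ b
fromℕ-+ a b
  rewrite fromℕ≡mkℚ a | fromℕ≡mkℚ b | ℤ.*-identityʳ (ℤ.+ a) | ℤ.*-identityʳ (ℤ.+ b) = refl

fromℕ-mono-≤ : ∀ {a b} → a ℕ.≤ b → fromℕ a ≤ fromℕ b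
fromℕ-mono-≤ {a} {b} a≤b = begin
  fromℕ a                     ≡⟨ ℚ.+-identityʳ (fromℕ a) ⟨
  fromℕ a + 0ℚ                ≤⟨ ℚ.+-monoʳ-≤ (fromℕ a) b∸a≥0 ⟩
  fromℕ a + fromℕ (b ℕ.∸ a)   ≡⟨ fromℕ-+ a (b ℕ.∸ a) ⟨
  fromℕ (a ℕ.+ (b ℕ.∸ a))     ≡⟨ cong fromℕ (ℕ.m+[n∸m]≡n a≤b) ⟩
  fromℕ b                     ∎
  where
  open ℚ.≤-Reasoning
  b∸a≥0 : 0ℚ ≤ fromℕ (b ℕ.∸ a)
  b∸a≥0 = ℚ.nonNegative⁻¹ _ {{ℚ.normalize-nonNeg (b ℕ.∸ a) 1}}

Σℚ-map-cong : ∀ {A : Set} {f g : A → ℚ} → (∀ a → f a ≡ g a) →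
              ∀ xs → Σℚ (map f xs) ≡ Σℚ (map g xs)
Σℚ-map-cong f≗g []       = refl
Σℚ-map-cong f≗g (a ∷ xs) = cong₂ _+_ (f≗g a) (Σℚ-map-cong f≗g xs)

Σℚ-map-+ : ∀ {A : Set} (f g : A → ℚ) xs →
           Σℚ (map (λ a → f a + g a) xs) ≡ Σℚ (map f xs) + Σℚ (map g xs)
Σℚ-map-+ f g []       = refl
Σℚ-map-+ f g (a ∷ xs) = begin
  (f a + g a) + Σℚ (map (λ a → f a + g a) xs)     ≡⟨ cong ((f a + g a) +_) (Σℚ-map-+ f g xs) ⟩
  (f a + g a) + (Σℚ (map f xs) + Σℚ (map g xs))   ≡⟨ interchange (f a) (g a) _ _ ⟩
  (f a + Σℚ (map f xs)) + (g a + Σℚ (map g xs))   ∎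
  where open ≡-Reasoning

module _ {n : ℕ} where

  WeightedPoints : Set
  WeightedPoints = List (ℚ × (Node n → Node n → ℕ))

  combination : WeightedPoints → Node n → Node n → ℚ
  combination cs u w = Σℚ (map (λ c → proj₁ c * fromℕ (proj₂ c u w)) cs)

  weightedSum : WeightedPoints → ((Node n → Node n → ℕ) → ℕ) → ℚ
  weightedSum cs F = Σℚ (map (λ c → proj₁ c * fromℕ (F (proj₂ c))) cs)

  weightedSum-0 : ∀ cs → weightedSum cs (λ _ → 0) ≡ 0ℚ
  weightedSum-0 []              = refl
  weightedSum-0 ((λc , _) ∷ cs) = cong₂ _+_ (ℚ.*-zeroʳ λc) (weightedSum-0 cs)

  weightedSum-+ : ∀ cs F G → weightedSum cs (λ x → F x ℕ.+ G x) ≡ weightedSum cs F + weightedSum cs G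
  weightedSum-+ cs F G = trans (Σℚ-map-cong distrib cs) (Σℚ-map-+ _ _ cs)
    where
    distrib : ∀ (c : ℚ × (Node n → Node n → ℕ)) →
              proj₁ c * fromℕ (F (proj₂ c) ℕ.+ G (proj₂ c))
              ≡ proj₁ c * fromℕ (F (proj₂ c)) + proj₁ c * fromℕ (G (proj₂ c))
    distrib (λc , x) = trans (cong (λc *_) (fromℕ-+ (F x) (G x))) (ℚ.*-distribˡ-+ λc _ _)

  weightedSum-mono-≤ : ∀ {P : (Node n → Node n → ℕ) → Set} {F G} cs →
                       All (λ c → 0ℚ ≤ proj₁ c × P (proj₂ c)) cs →
                       (∀ x → P x → F x ℕ.≤ G x) → weightedSum cs F ≤ weightedSum cs G
  weightedSum-mono-≤ []       []                 F≤G = ℚ.≤-refl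
  weightedSum-mono-≤ (c ∷ cs) ((λc≥0 , Px) ∷ ok) F≤G =
    ℚ.+-mono-≤ (ℚ.*-monoˡ-≤-nonNeg (proj₁ c) {{ℚ.nonNegative λc≥0}} (fromℕ-mono-≤ (F≤G _ Px)))
               (weightedSum-mono-≤ cs ok F≤G)

  -- ψ is the same form on integer points, ℕ-valued so that inequalities between
  -- forms can be proved combinatorially there.
  record LinearForm : Set where
    field
      φ             : (Node n → Node n → ℚ) → ℚ
      ψ             : (Node n → Node n → ℕ) → ℕ
      φ-cong        : ∀ {y y′} → (∀ u w → y u w ≡ y′ u w) → φ y ≡ φ y′
      φ-combination : ∀ cs → φ (combination cs) ≡ weightedSum cs ψ
  open LinearForm

  coordinate : Node n → Node n → LinearForm
  coordinate u w = record
    { φ             = λ y → y u w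
    ; ψ             = λ x → x u w
    ; φ-cong        = λ y≗y′ → y≗y′ u w
    ; φ-combination = λ _ → refl
    }

  when : Bool → LinearForm → LinearForm
  when b L = record
    { φ             = λ y → if b then φ L y else 0ℚ
    ; ψ             = λ x → if b then ψ L x else 0
    ; φ-cong        = cong-when b
    ; φ-combination = combination-when b
    }
    where
    cong-when : ∀ b {y y′} → (∀ u w → y u w ≡ y′ u w) →
                (if b then φ L y else 0ℚ) ≡ (if b then φ L y′ else 0ℚ)
    cong-when true  y≗y′ = φ-cong L y≗y′
    cong-when false _    = refl

    combination-when : ∀ b cs → (if b then φ L (combination cs) else 0ℚ)
                                ≡ weightedSum cs (λ x → if b then ψ L x else 0)
    combination-when true  cs = φ-combination L cs
    combination-when false cs = sym (weightedSum-0 cs)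

  infixl 6 _+ᶠ_
  _+ᶠ_ : LinearForm → LinearForm → LinearForm
  L +ᶠ M = record
    { φ             = λ y → φ L y + φ M y
    ; ψ             = λ x → ψ L x ℕ.+ ψ M x
    ; φ-cong        = λ y≗y′ → cong₂ _+_ (φ-cong L y≗y′) (φ-cong M y≗y′)
    ; φ-combination = λ cs → trans (cong₂ _+_ (φ-combination L cs) (φ-combination M cs))
                                   (sym (weightedSum-+ cs (ψ L) (ψ M)))
    }

  Σᶠ : ∀ {E : Set} → List E → (E → LinearForm) → LinearForm
  Σᶠ {E} es F = record
    { φ             = λ y → Σℚ (map (λ e → φ (F e) y) es)
    ; ψ             = ψ-Σ es
    ; φ-cong        = λ y≗y′ → Σℚ-map-cong (λ e → φ-cong (F e) y≗y′) es
    ; φ-combination = combination-Σ es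
    }
    where
    ψ-Σ : List E → (Node n → Node n → ℕ) → ℕ
    ψ-Σ es x = sum (map (λ e → ψ (F e) x) es)

    combination-Σ : ∀ es cs →
                    Σℚ (map (λ e → φ (F e) (combination cs)) es) ≡ weightedSum cs (ψ-Σ es)
    combination-Σ []       cs = sym (weightedSum-0 cs)
    combination-Σ (e ∷ es) cs =
      trans (cong₂ _+_ (φ-combination (F e) cs) (combination-Σ es cs))
            (sym (weightedSum-+ cs (ψ (F e)) (ψ-Σ es)))

module _ {n : ℕ} (G : DAG n) where
  open LinearForm

  valid-on-hull : (L M : LinearForm) → (∀ x → Admissible G x → ψ L x ℕ.≤ ψ M x) →
                  ∀ {y} → InP G y → φ L y ≤ φ M y
  -- The weights need not sum to 1, as both sides are linear.
  valid-on-hull L M valid {y} (cs , admissible , _ , y≡) = begin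
    φ L y                  ≡⟨ φ-cong L y≡ ⟩
    φ L (combination cs)   ≡⟨ φ-combination L cs ⟩
    weightedSum cs (ψ L)   ≤⟨ weightedSum-mono-≤ cs admissible valid ⟩
    weightedSum cs (ψ M)   ≡⟨ φ-combination M cs ⟨
    φ M (combination cs)   ≡⟨ φ-cong M y≡ ⟨
    φ M y                  ∎
    where open ℚ.≤-Reasoning

-- Paths of Ḡ

Reach-trans : ∀ {n} {E : Fin n → Fin n → Bool} → Transitive (Reach E)
Reach-trans (one e)    q = more e q
Reach-trans (more e p) q = more e (Reach-trans p q)

module _ {n : ℕ} (G : DAG n) where
  open DAG G

  Reach-isStrictPartialOrder : IsStrictPartialOrder _≡_ (Reach A)
  Reach-isStrictPartialOrder = record
    { isEquivalence = isEquivalence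
    ; irrefl        = λ { refl → acyclic _ }
    ; trans         = Reach-trans
    ; <-resp-≈      = (λ { refl r → r }) , (λ { refl r → r })
    }

  Reach-wellFounded : WellFounded (Reach A)
  Reach-wellFounded = spo-wellFounded Reach-isStrictPartialOrder

  Reach-noetherian : WellFounded (flip (Reach A))
  Reach-noetherian = spo-noetherian Reach-isStrictPartialOrder

  ∈-allNodes : ∀ u → u ∈ allNodes n
  ∈-allNodes src     = here refl
  ∈-allNodes (mid i) = there (∈-++⁺ˡ (∈-map⁺ mid (∈-allFin i)))
  ∈-allNodes snk     = there (∈-++⁺ʳ (map mid (allFin n)) (here refl))

  linked⇒isPath : ∀ {u us} → Linked (λ v w → T (arcBar G v w)) (u ∷ us) → IsPath G (u ∷ us)
  linked⇒isPath [-]     = single _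
  linked⇒isPath (e ∷ L) = cons e (linked⇒isPath L)

  arcOn-walk : ∀ {ℓ} {R : Rel (Node n) ℓ} {c cs e u w} →
               Walk R c cs e → ArcOn G u w (c ∷ cs ++ e ∷ []) →
               Star R c u × R u w × Star R w e
  arcOn-walk {cs = []}    (r ∷ [-]) here               = ε , r , ε
  arcOn-walk {cs = []}    (r ∷ [-]) (there (there ()))
  arcOn-walk {cs = _ ∷ _} (r ∷ W)   here               = ε , r , walk⇒Star W
  arcOn-walk {cs = _ ∷ _} (r ∷ W)   (there on) with c↝u , u⟶w , w↝e ← arcOn-walk W on =
    r ◅ c↝u , u⟶w , w↝e

  arcOn-split : ∀ {u w c e m} qs rs → ArcOn G u w (c ∷ (qs ++ m ∷ rs) ++ e ∷ []) →
                ArcOn G u w (c ∷ qs ++ m ∷ []) ⊎ ArcOn G u w (m ∷ rs ++ e ∷ [])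
  arcOn-split []       rs here       = inj₁ here
  arcOn-split []       rs (there on) = inj₂ on
  arcOn-split (q ∷ qs) rs here       = inj₁ here
  arcOn-split (q ∷ qs) rs (there on) = Sum.map₁ there (arcOn-split qs rs on)

  feasible-split : ∀ {c e m} qs rs → Feasible G (c ∷ (qs ++ m ∷ rs) ++ e ∷ []) →
                   Feasible G (c ∷ qs ++ m ∷ []) ⊎ Feasible G (m ∷ rs ++ e ∷ [])
  feasible-split qs rs (u , w , on , ǎ) =
    Sum.map (λ on′ → u , w , on′ , ǎ) (λ on′ → u , w , on′ , ǎ) (arcOn-split qs rs on)

  feasible? : ∀ ps → Dec (Feasible G ps)
  feasible? []           = no λ ()
  feasible? (u ∷ [])     = no λ { (_ , _ , there () , _) }
  feasible? (u ∷ w ∷ ws) with T? (checkArc G u w) | feasible? (w ∷ ws)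
  ... | yes ǎ | _                    = yes (u , w , here , ǎ)
  ... | no _  | yes (a , b , on , ǎ) = yes (a , b , there on , ǎ)
  ... | no ¬ǎ | no ¬feasible         =
    no λ { (_ , _ , here , ǎ) → ¬ǎ ǎ ; (a , b , there on , ǎ) → ¬feasible (a , b , on , ǎ) }

  crossing : ∀ {p q} {P : Node n → Set p} {Q : Node n → Set q} → (∀ v → P v ⊎ Q v) →
             ∀ {c ds} → P c → Any Q ds → ∃₂ λ u w → ArcOn G u w (c ∷ ds) × P u × Q w
  crossing P⊎Q Pc (here Qd) = _ , _ , here , Pc , Qd
  crossing P⊎Q {ds = d ∷ _} Pc (there Q∈ds) with P⊎Q d
  ... | inj₂ Qd = _ , _ , here , Pc , Qd
  ... | inj₁ Pd with u , w , on , Pu , Qw ← crossing P⊎Q Pd Q∈ds = u , w , there on , Pu , Qw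

-- Integer points of 𝒫

module IntegerPoint {n : ℕ} (G : DAG n) {x : Node n → Node n → ℕ} (adm : Admissible G x) where
  open DAG G
  open Admissible adm

  infix 4 _↦_ _↝_

  _↦_ : Rel (Node n) 0ℓ
  u ↦ w = x u w ≡ 1

  _↝_ : Rel (Node n) 0ℓ
  _↝_ = Star _↦_

  masked≡ : ∀ u w → (if arcBar G u w then x u w else 0) ≡ x u w
  masked≡ u w with arcBar G u w in arc
  ... | true  = refl
  ... | false = sym (support u w arc)

  ↦⇒masked-pos : ∀ {u w} → u ↦ w → 0 < (if arcBar G u w then x u w else 0)
  ↦⇒masked-pos {u} {w} u↦w rewrite masked≡ u w = ≤-reflexive (sym u↦w)

  masked-pos⇒↦ : ∀ {u w} → 0 < (if arcBar G u w then x u w else 0) → u ↦ w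
  masked-pos⇒↦ {u} {w} x>0 rewrite masked≡ u w = ℕ.≤-antisym (binary u w) x>0

  ↦⇒arc : ∀ {u w} → u ↦ w → T (arcBar G u w)
  ↦⇒arc {u} {w} u↦w with arcBar G u w in arc
  ... | true  = tt
  ... | false with () ← trans (sym (support u w arc)) u↦w

  ↛src : ∀ {u} → ¬ (u ↦ src)
  ↛src {src}   = ↦⇒arc
  ↛src {mid _} = ↦⇒arc
  ↛src {snk}   = ↦⇒arc

  snk↛ : ∀ {w} → ¬ (snk ↦ w)
  snk↛ = ↦⇒arc

  ↦⇒target≢src : ∀ {u w} → u ↦ w → w ≢ src
  ↦⇒target≢src u↦w refl = ↛src u↦w

  ↦⇒source≢snk : ∀ {u w} → u ↦ w → u ≢ snk
  ↦⇒source≢snk u↦w refl = snk↛ u↦w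

  ↦⇒in-pos : ∀ {u w} → u ↦ w → 0 < inSumℕ G x w
  ↦⇒in-pos {u} u↦w = ≤-trans (↦⇒masked-pos u↦w) (∈⇒≤sum-map _ (∈-allNodes G u))

  ↦⇒out-pos : ∀ {u w} → u ↦ w → 0 < outSumℕ G x u
  ↦⇒out-pos {w = w} u↦w = ≤-trans (↦⇒masked-pos u↦w) (∈⇒≤sum-map _ (∈-allNodes G w))

  in-pos⇒↦ : ∀ {w} → 0 < inSumℕ G x w → ∃ λ u → u ↦ w
  in-pos⇒↦ in>0 with u , masked>0 ← sum-map-pos⇒∃-pos _ (allNodes n) in>0 =
    u , masked-pos⇒↦ masked>0

  out-pos⇒↦ : ∀ {u} → 0 < outSumℕ G x u → ∃ λ w → u ↦ w
  out-pos⇒↦ out>0 with w , masked>0 ← sum-map-pos⇒∃-pos _ (allNodes n) out>0 =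
    w , masked-pos⇒↦ masked>0

  ↦-deterministic : ∀ {u a b} → u ≢ src → u ↦ a → u ↦ b → a ≡ b
  ↦-deterministic {src}           u≢src = contradiction refl u≢src
  ↦-deterministic {snk}           _     = ⊥-elim ∘ snk↛
  ↦-deterministic {mid k} {a} {b} _ k↦a k↦b =
    sum-map≤1⇒pos-unique _ (subst (ℕ._≤ 1) (flow k) (indeg≤1 k)) (∈-allNodes G a) (∈-allNodes G b)
      (↦⇒masked-pos k↦a) (↦⇒masked-pos k↦b)

  ↦-codeterministic : ∀ {w a b} → w ≢ snk → a ↦ w → b ↦ w → a ≡ b
  ↦-codeterministic {src}           _     = ⊥-elim ∘ ↛src
  ↦-codeterministic {snk}           w≢snk = contradiction refl w≢snk
  ↦-codeterministic {mid k} {a} {b} _ a↦k b↦k =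
    sum-map≤1⇒pos-unique _ (indeg≤1 k) (∈-allNodes G a) (∈-allNodes G b)
      (↦⇒masked-pos a↦k) (↦⇒masked-pos b↦k)

  ↝-comparable-from : ∀ {v a b} → v ≢ src → v ↝ a → v ↝ b → a ↝ b ⊎ b ↝ a
  ↝-comparable-from = Star-comparable ↦-deterministic ↦⇒target≢src

  ↝-comparable-to : ∀ {v a b} → v ≢ snk → a ↝ v → b ↝ v → a ↝ b ⊎ b ↝ a
  ↝-comparable-to v≢snk a↝v b↝v =
    Sum.swap (Sum.map (reverse id) (reverse id)
      (Star-comparable {_⟶_ = flip _↦_} ↦-codeterministic ↦⇒source≢snk
                       v≢snk (reverse id a↝v) (reverse id b↝v)))

  ↝⇒path : ∀ {u v} → u ↝ v → ∃ λ ps → IsPath G (u ∷ ps) × v ∈ u ∷ ps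
  ↝⇒path ε         = [] , single _ , here refl
  ↝⇒path (r ◅ u↝v) with ps , path , v∈ps ← ↝⇒path u↝v =
    _ ∷ ps , cons (↦⇒arc r) path , there v∈ps

  ↝-conflict : ∀ {i j} → Conflicting G i j → ¬ (mid i ↝ mid j ⊎ mid j ↝ mid i)
  ↝-conflict conflict (inj₁ i↝j) with _ , path , j∈ ← ↝⇒path i↝j =
    conflict (_ , path , here refl , j∈)
  ↝-conflict conflict (inj₂ j↝i) with _ , path , i∈ ← ↝⇒path j↝i =
    conflict (_ , path , i∈ , here refl)

  walk⇒isPath : ∀ {u vs w} → Walk _↦_ u vs w → IsPath G (u ∷ vs ++ w ∷ [])
  walk⇒isPath W = linked⇒isPath G (Linked.map ↦⇒arc W)

  walk-pathSum : ∀ {u vs w} → Walk _↦_ u vs w → pathSumℕ G x (u ∷ vs ++ w ∷ []) ≡ suc (length vs)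
  walk-pathSum {vs = []}    (u↦w ∷ [-]) = cong (ℕ._+ 0) u↦w
  walk-pathSum {vs = _ ∷ _} (u↦v ∷ W)   = cong₂ ℕ._+_ u↦v (walk-pathSum W)

  -- x takes the value 1 on all |qs| + 1 arcs of the walk, more than an infeasible path allows.
  walk-feasible : ∀ {qs} → Walk _↦_ src qs snk → Feasible G (src ∷ qs ++ snk ∷ [])
  walk-feasible {qs} W with feasible? G (src ∷ qs ++ snk ∷ [])
  ... | yes feasible  = feasible
  ... | no infeasible =
    contradiction (subst (ℕ._≤ length qs) (walk-pathSum W) (infeas qs (walk⇒isPath W) infeasible))
                  (n≮n _)

  walk-from-src : ∀ i → Acc (Reach A) i → 0 < inSumℕ G x (mid i) →
                  ∃ λ qs → Walk _↦_ src qs (mid i)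
  walk-from-src i (acc rec) in>0 with in-pos⇒↦ in>0
  ... | src   , src↦i = [] , src↦i ∷ [-]
  ... | snk   , snk↦i = contradiction snk↦i snk↛
  ... | mid j , j↦i
    with qs , W ← walk-from-src j (rec (one (↦⇒arc j↦i)))
                    (subst (0 <_) (sym (flow j)) (↦⇒out-pos j↦i))
       = qs ++ mid j ∷ [] , walk-++ W (j↦i ∷ [-])

  walk-to-snk : ∀ i → Acc (flip (Reach A)) i → 0 < inSumℕ G x (mid i) →
                ∃ λ rs → Walk _↦_ (mid i) rs snk
  walk-to-snk i (acc rec) in>0 with out-pos⇒↦ (subst (0 <_) (flow i) in>0)
  ... | snk   , i↦snk = [] , i↦snk ∷ [-]
  ... | src   , i↦src = contradiction i↦src ↛src
  ... | mid j , i↦j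
    with rs , W ← walk-to-snk j (rec (one (↦⇒arc i↦j))) (↦⇒in-pos i↦j)
       = mid j ∷ rs , i↦j ∷ W

-- Charging the nodes of T to arcs crossing S

module CrossingArcs {n : ℕ} (G : DAG n) (S Tset : Fin n → Bool)
  (T⊆S : ∀ i → T (Tset i) → T (S i))
  (conflicting : ConflictingSet G Tset)
  (χ⁻ χ⁺ : Node n → Node n → Bool)
  (A⁻⊆χ⁻ : ∀ {u w} → InAminusT G Tset u w → T (χ⁻ u w))
  (A⁺⊆χ⁺ : ∀ {u w} → InAplusT G Tset u w → T (χ⁺ u w)) where

  entering leaving : Node n → Node n → Bool
  entering u w = arcBar G u w ∧ not (inS G S u) ∧ inS G S w ∧ χ⁻ u w
  leaving  u w = arcBar G u w ∧ inS G S u ∧ not (inS G S w) ∧ χ⁺ u w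

  module _ {x : Node n → Node n → ℕ} (adm : Admissible G x) where
    open IntegerPoint G adm
    open Admissible adm

    record CrossingArc (i : Fin n) : Set where
      field
        tail head : Node n
        tail↦head : tail ↦ head
        side      : (T (entering tail head) × head ↝ mid i) ⊎ (T (leaving tail head) × mid i ↝ tail)

      endpoints : Node n × Node n
      endpoints = tail , head
    open CrossingArc

    crossingArc : ∀ {i} → T (Tset i) → 0 < inSumℕ G x (mid i) → CrossingArc i
    crossingArc {i} i∈T in>0
      with qs , Wq ← walk-from-src i (Reach-wellFounded G i) in>0
         | rs , Wr ← walk-to-snk i (Reach-noetherian G i) in>0
      with feasible-split G qs rs (walk-feasible (walk-++ Wq Wr))
    ... | inj₁ prefix-feasible
      with u , w , on , u∉S , w∈S ←
             crossing G (T-not⊎T ∘ inS G S) tt (++⁺ʳ qs (here (T⊆S i i∈T)))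
      with _ , u↦w , w↝i ← arcOn-walk G Wq on
      = record { tail = u ; head = w ; tail↦head = u↦w ; side = inj₁ (enters , w↝i) }
      where
      enters : T (entering u w)
      enters = ∧-intro (↦⇒arc u↦w) (∧-intro u∉S (∧-intro w∈S
                 (A⁻⊆χ⁻ (i , i∈T , qs , walk⇒isPath Wq , prefix-feasible , on))))
    ... | inj₂ suffix-feasible
      with u , w , on , u∈S , w∉S ←
             crossing G (Sum.swap ∘ T-not⊎T ∘ inS G S) (T⊆S i i∈T) (++⁺ʳ rs (here tt))
      with i↝u , u↦w , _ ← arcOn-walk G Wr on
      = record { tail = u ; head = w ; tail↦head = u↦w ; side = inj₂ (leaves , i↝u) }
      where
      leaves : T (leaving u w)
      leaves = ∧-intro (↦⇒arc u↦w) (∧-intro u∈S (∧-intro w∉S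
                 (A⁺⊆χ⁺ (i , i∈T , rs , walk⇒isPath Wr , suffix-feasible , on))))

    crossingArc-comparable : ∀ {i j} (a : CrossingArc i) (b : CrossingArc j) →
                             endpoints a ≡ endpoints b → mid i ↝ mid j ⊎ mid j ↝ mid i
    crossingArc-comparable a b same with side a | side b | same
    ... | inj₁ (_ , w↝i) | inj₁ (_ , w↝j) | refl =
      ↝-comparable-from (↦⇒target≢src (tail↦head a)) w↝i w↝j
    ... | inj₁ (_ , w↝i) | inj₂ (_ , j↝u) | refl = inj₂ (j↝u ◅◅ tail↦head a ◅ w↝i)
    ... | inj₂ (_ , i↝u) | inj₁ (_ , w↝j) | refl = inj₁ (i↝u ◅◅ tail↦head a ◅ w↝j)
    ... | inj₂ (_ , i↝u) | inj₂ (_ , j↝u) | refl =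
      ↝-comparable-to (↦⇒source≢snk (tail↦head a)) i↝u j↝u

    demand : Fin n → ℕ
    demand i = if Tset i then inSumℕ G x (mid i) else 0

    supply : Node n × Node n → ℕ
    supply (u , w) = (if entering u w then x u w else 0) ℕ.+ (if leaving u w then x u w else 0)

    supply-pos : ∀ {i} (a : CrossingArc i) → 0 < supply (endpoints a)
    supply-pos a with side a
    ... | inj₁ (enters , _) =
      ≤-trans (≤-reflexive (sym (trans (if-T enters) (tail↦head a)))) (m≤m+n _ _)
    ... | inj₂ (leaves , _) =
      ≤-trans (≤-reflexive (sym (trans (if-T leaves) (tail↦head a)))) (m≤n+m _ _)

    charge : ∀ i → 0 < demand i → CrossingArc i
    charge i demand>0 =
      crossingArc (proj₁ (if-pos (Tset i) demand>0)) (proj₂ (if-pos (Tset i) demand>0))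

    demand≤supply : ∀ i demand>0 → demand i ℕ.≤ supply (endpoints (charge i demand>0))
    demand≤supply i demand>0 = begin
      demand i               ≡⟨ if-T (proj₁ (if-pos (Tset i) demand>0)) ⟩
      inSumℕ G x (mid i)     ≤⟨ indeg≤1 i ⟩
      1                      ≤⟨ supply-pos a ⟩
      supply (endpoints a)   ∎
      where
      open ℕ.≤-Reasoning
      a : CrossingArc i
      a = charge i demand>0

    charge-injective : ∀ {i j} i>0 j>0 → i ≢ j →
                       endpoints (charge i i>0) ≢ endpoints (charge j j>0)
    charge-injective {i} {j} i>0 j>0 i≢j same =
      ↝-conflict (conflicting i j (proj₁ (if-pos (Tset i) i>0)) (proj₁ (if-pos (Tset j) j>0)) i≢j)
                 (crossingArc-comparable (charge i i>0) (charge j j>0) same)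

    sum-demand≤sum-supply :
      sum (map demand (allFin n)) ℕ.≤ sum (map supply (cartesianProduct (allNodes n) (allNodes n)))
    sum-demand≤sum-supply =
      sum-map-≤-injection demand supply (λ i → endpoints ∘ charge i) demand≤supply charge-injective
        (allFin⁺ n) (λ _ _ → ∈-cartesianProduct⁺ (∈-allNodes G _) (∈-allNodes G _))

  open LinearForm

  lhs : LinearForm
  lhs = Σᶠ (allFin n) λ i → when (Tset i) (
          Σᶠ (allNodes n) λ u → when (arcBar G u (mid i)) (coordinate u (mid i)))

  rhs : LinearForm
  rhs = Σᶠ (cartesianProduct (allNodes n) (allNodes n)) λ (u , w) →
          when (entering u w) (coordinate u w) +ᶠ when (leaving u w) (coordinate u w)

  φ-rhs : ∀ y → φ rhs y ≡ sumPairs G entering y + sumPairs G leaving y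
  φ-rhs y = trans (Σℚ-map-+ restrict-entering restrict-leaving (cartesianProduct nodes nodes))
                  (cong₂ _+_ (cong Σℚ (map-cartesianProduct restrict-entering nodes nodes))
                             (cong Σℚ (map-cartesianProduct restrict-leaving nodes nodes)))
    where
    nodes : List (Node n)
    nodes = allNodes n
    restrict-entering restrict-leaving : Node n × Node n → ℚ
    restrict-entering (u , w) = if entering u w then y u w else 0ℚ
    restrict-leaving  (u , w) = if leaving u w then y u w else 0ℚ

proposition7 : ∀ {n : ℕ} (G : DAG n) (S Tset : Fin n → Bool)
    → (∀ i → T (Tset i) → T (S i))
    → ConflictingSet G Tset
    → (χ⁻ χ⁺ : Node n → Node n → Bool)
    → (∀ u w → (T (χ⁻ u w) → InAminusT G Tset u w) × (InAminusT G Tset u w → T (χ⁻ u w)))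
    → (∀ u w → (T (χ⁺ u w) → InAplusT G Tset u w) × (InAplusT G Tset u w → T (χ⁺ u w)))
    → (y : Node n → Node n → ℚ)
    → InP G y
    → sumℚ G (map (λ i → if Tset i then z G y i else 0ℚ) (allFin n))
      ≤ (sumPairs G (λ u w → arcBar G u w ∧ not (inS G S u) ∧ inS G S w ∧ χ⁻ u w) y
         + sumPairs G (λ u w → arcBar G u w ∧ inS G S u ∧ not (inS G S w) ∧ χ⁺ u w) y)
proposition7 G S Tset T⊆S conflicting χ⁻ χ⁺ χ⁻-spec χ⁺-spec y y∈P =
  subst (_ ≤_) (φ-rhs y) (valid-on-hull G lhs rhs (λ _ → sum-demand≤sum-supply) y∈P)
  where
  open CrossingArcs G S Tset T⊆S conflicting χ⁻ χ⁺ (proj₂ (χ⁻-spec _ _)) (proj₂ (χ⁺-spec _ _))
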